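{- Let $p\geq 2$, let $G$ be a $2p$-regular graph, let $\vec{G}$ be an orientation of $G$ and let $f$ be a $(p+2)$-colouring of $G$. Then $f$ is a star colouring of $G$ if and only if every bicoloured component of $(G,f)$ is isomorphic to $K_{1,p}$. Moreover, the following are equivalent, where $\mathrm{proj}_2\colon V(\vec{L}(K_{p+2}))\to\mathbb{Z}_{p+2}$ is the map $(i,j)\mapsto j$: (I) $f$ is a star colouring of $G$ and $\vec{G}$ is the in-orientation of $G$ induced by $f$; (II) $(\vec{G},f)$ is a $(p+2)$-coloured MINI-orientation of $G$; (III) $\vec{G}$ admits an out-neighbourhood bijective homomorphism $\psi$ to $\vec{L}(K_{p+2})$ with $\mathrm{proj}_2\circ\psi=f$.
   Context: A $k$-colouring is a map $V(G)\to\mathbb{Z}_k$ with adjacent vertices coloured differently; a bicoloured component of $(G,f)$ is a connected component of the subgraph induced by two colour classes. A star colouring is a colouring in which every bicoloured component is a star $K_{1,q}$ ($q\ge0$). For a star colouring $f$, an in-orientation of $G$ induced by $f$ is an orientation obtained by orienting the two edges of every 3-vertex path whose vertices use only two colours towards the middle vertex, and orienting the remaining edges arbitrarily. $(\vec{G},f)$ is a $q$-coloured MINI-orientation if $f$ is a $q$-colouring and for every vertex $v$: (i) no out-neighbour of $v$ has the same colour as an in-neighbour of $v$; (ii) the out-neighbours of $v$ have pairwise distinct colours; (iii) all in-neighbours of $v$ have the same colour. $\vec{L}(K_{p+2})$ is the oriented graph on the ordered pairs $(i,j)$ of distinct elements of $\mathbb{Z}_{p+2}$ with an arc from $(i,j)$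 to $(j,k)$ whenever $k\neq i$. An out-neighbourhood bijective homomorphism from $\vec{G}$ to $\vec{H}$ is a map $\psi$ such that for every $v$ the restriction of $\psi$ to $N^+_{\vec{G}}(v)$ is a bijection onto $N^+_{\vec{H}}(\psi(v))$. -}

module Defs where

open import Data.Nat using (ℕ; zero; suc; _+_; _*_)
open import Data.Fin using (Fin)
open import Data.Bool using (Bool; true; false; _∨_)
open import Data.List using (List; length; filterᵇ; allFin)
open import Data.Product using (Σ; ∃; ∃-syntax; _×_; _,_; proj₁; proj₂)
open import Data.Sum using (_⊎_)
open import Relation.Binary.PropositionalEquality using (_≡_; _≢_)
open import Relation.Nullary using (¬_)

record Graph : Set where
  field
    n      : ℕ
    adj    : Fin n → Fin n → Bool
    sym    : ∀ u v → adj u v ≡ adj v u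
    irrefl : ∀ v → adj v v ≡ false

module _ (G : Graph) where
  open Graph G

  Adj : Fin n → Fin n → Set
  Adj u v = adj u v ≡ true

  degree : Fin n → ℕ
  degree v = length (filterᵇ (adj v) (allFin n))

  Regular : ℕ → Set
  Regular d = ∀ v → degree v ≡ d

  -- An orientation: a set of arcs (o u v ≡ true means arc u → v) such that
  -- every edge gets exactly one direction and non-edges get none.
  IsOrientation : (Fin n → Fin n → Bool) → Set
  IsOrientation o = (∀ u v → (o u v ∨ o v u) ≡ adj u v)
                  × (∀ u v → ¬ (o u v ≡ true × o v u ≡ true))

  IsColouring : (k : ℕ) → (Fin n → Fin k) → Set
  IsColouring k f = ∀ u v → Adj u v → f u ≢ f v

  data Reach (S : Fin n → Set) : Fin n → Fin n → Set where
    here : ∀ {v} → S v → Reach S v v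
    step : ∀ {u v w} → Reach S u v → Adj v w → S w → Reach S u w

  StarAdj : {q : ℕ} → Fin (suc q) → Fin (suc q) → Set
  StarAdj {q} i j = (i ≡ Fin.zero × j ≢ Fin.zero) ⊎ (i ≢ Fin.zero × j ≡ Fin.zero)

  InducedIsoStar : (C : Fin n → Set) → ℕ → Set
  InducedIsoStar C q =
    Σ (Fin (suc q) → Fin n) λ φ →
        (∀ i j → φ i ≡ φ j → i ≡ j)
      × (∀ w → C w → ∃[ i ] φ i ≡ w)
      × (∀ i → C (φ i))
      × (∀ i j → (Adj (φ i) (φ j) → StarAdj i j) × (StarAdj i j → Adj (φ i) (φ j)))

  module _ {k : ℕ} (f : Fin n → Fin k) where

    TwoColoured : Fin k → Fin k → Fin n → Set
    TwoColoured a b w = f w ≡ a ⊎ f w ≡ b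

    -- The bicoloured component of (G,f) for the distinct colours a, b
    -- containing the vertex v (with f v ∈ {a,b}) is { w | Reach v w }.
    -- Property P holds for every bicoloured component:
    EveryBicolouredComponent : ((Fin n → Set) → Set) → Set
    EveryBicolouredComponent P =
      ∀ (a b : Fin k) → a ≢ b → ∀ v → TwoColoured a b v →
        P (λ w → Reach (TwoColoured a b) v w)

    IsStarColouring : Set
    IsStarColouring = IsColouring k f
                    × EveryBicolouredComponent (λ C → ∃[ q ] InducedIsoStar C q)

    AllBicolouredComponentsK1 : ℕ → Set
    AllBicolouredComponentsK1 p = EveryBicolouredComponent (λ C → InducedIsoStar C p)

    IsInOrientation : (Fin n → Fin n → Bool) → Set
    IsInOrientation o =
      IsOrientation o ×
      (∀ u v w → u ≢ w → Adj u v → Adj v w → f u ≡ f w →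
         (o u v ≡ true × o w v ≡ true))

    IsMINI : (Fin n → Fin n → Bool) → Set
    IsMINI o =
      IsOrientation o × IsColouring k f ×
      (∀ v x y → o v x ≡ true → o y v ≡ true → f x ≢ f y) ×
      (∀ v x y → o v x ≡ true → o v y ≡ true → x ≢ y → f x ≢ f y) ×
      (∀ v x y → o x v ≡ true → o y v ≡ true → f x ≡ f y)

-- The oriented line graph L(K_m): vertices are pairs (i,j) with i ≢ j;
-- arc (i,j) → (j',k) iff j' ≡ j and k ≢ i.
LArc : {m : ℕ} → Fin m × Fin m → Fin m × Fin m → Set
LArc (i , j) (j' , k) = j' ≡ j × k ≢ i

proj2 : {m : ℕ} → Fin m × Fin m → Fin m
proj2 = proj₂

module _ (G : Graph) where
  open Graph G

  IsOutNbhdBijHom : (m : ℕ) → (Fin n → Fin n → Bool) → (Fin n → Fin m × Fin m) → Set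
  IsOutNbhdBijHom m o ψ =
      (∀ v → proj₁ (ψ v) ≢ proj₂ (ψ v))
    × (∀ v x → o v x ≡ true → LArc (ψ v) (ψ x))
    × (∀ v x y → o v x ≡ true → o v y ≡ true → ψ x ≡ ψ y → x ≡ y)
    × (∀ v t → proj₁ t ≢ proj₂ t → LArc (ψ v) t → ∃[ x ] (o v x ≡ true × ψ x ≡ t))

{-# OPTIONS --safe #-}
module Submission where

-- Let o satisfy conditions (i) and (ii) of a MINI-orientation. Around a vertex v with an
-- in-neighbour y, the colour of v, the colour of y and the colours of the out-neighbours of v
-- are pairwise distinct, so with p + 2 colours v has out-degree at most p (a vertex without
-- in-neighbours would need 2p + 1 colours). Out- and in-degrees have the same sum and add up
-- to 2p at every vertex, hence both are p everywhere. Then a second in-colour at v would be a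
-- (p + 3)-rd colour, which gives (iii); the out-neighbours of v carry exactly the p colours
-- other than f v and the in-colour of v, which makes v ↦ (in-colour of v , f v) an
-- out-neighbourhood bijective homomorphism; and every bicoloured component is a vertex together
-- with its p in-neighbours, i.e. K_{1,p}. In-orientations of star colourings are exactly the
-- orientations satisfying (i) and (ii), and a star colouring has one: orient every edge towards
-- the middle of the bicoloured paths through it, which never conflict since a bicoloured
-- component contains no path on four vertices.

open import Data.Bool using (Bool; true; false; _∨_; _∧_; not)
import Data.Bool as Bool
open import Data.Bool.Properties using (T-≡)
open import Data.Empty using (⊥; ⊥-elim)
open import Data.Fin using (Fin; zero; suc)
open import Data.Fin.Properties using (pigeonhole; _≟_; any?) renaming (<⇒≢ to <⇒≢ᶠ)
open import Data.List using (List; []; _∷_; length; filterᵇ; lookup; map; allFin)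
open import Data.List.Membership.Propositional using (_∈_; _∉_)
open import Data.List.Membership.Propositional.Properties
  using (∈-lookup; ∈-allFin; ∈-filter⁺; ∈-filter⁻; ∈-map⁻)
open import Data.List.Properties using (length-map)
import Data.List.Relation.Unary.All as All
open import Data.List.Relation.Unary.All.Properties using () renaming (map⁺ to All-map⁺)
open import Data.List.Relation.Unary.AllPairs using ([]; _∷_)
open import Data.List.Relation.Unary.Any as Any using (here; there)
open import Data.List.Relation.Unary.Any.Properties using (lookup-index)
open import Data.List.Relation.Unary.Unique.Propositional using (Unique)
open import Data.List.Relation.Unary.Unique.Propositional.Properties
  using (allFin⁺) renaming (filter⁺ to Unique-filter⁺)
open import Data.Nat using (ℕ; suc; _+_; _*_; _≤_; _<_; z≤n; s≤s)
open import Data.Nat.ListAction using (sum)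
open import Data.Nat.Properties
  using (+-suc; +-comm; +-identityʳ; +-mono-≤; +-monoʳ-≤; +-mono-<-≤; +-cancelˡ-≡; +-cancelˡ-≤;
         +-cancelʳ-≤; *-cancelˡ-≡; ≤-trans; ≤-reflexive; <-irrefl; ≮⇒≥; <⇒≱; m≤m+n;
         m≤n⇒m<n∨m≡n;
         +-commutativeSemigroup)
open import Algebra.Properties.CommutativeSemigroup +-commutativeSemigroup using (x∙yz≈y∙xz)
open import Data.Product using (_×_; _,_; proj₁; proj₂; ∃-syntax)
open import Data.Sum using (_⊎_; inj₁; inj₂)
open import Function using (_∘_)
open import Function.Bundles using (Equivalence; _⇔_; mk⇔)
open import Relation.Binary.PropositionalEquality
open import Relation.Nullary using (¬_; Dec; yes; no; ¬?; _×-dec_)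
open import Relation.Nullary.Decidable using (T?; ⌊_⌋)

open import Defs

private variable A B : Set

length-filterᵇ-∨ : (P Q R : A → Bool) → (∀ x → P x ≡ Q x ∨ R x) →
                   (∀ x → ¬ (Q x ≡ true × R x ≡ true)) →
                   ∀ xs → length (filterᵇ P xs) ≡ length (filterᵇ Q xs) + length (filterᵇ R xs)
length-filterᵇ-∨ P Q R P≡Q∨R Q∩R≡∅ [] = refl
length-filterᵇ-∨ P Q R P≡Q∨R Q∩R≡∅ (x ∷ xs)
  with P x | Q x | R x | P≡Q∨R x | Q∩R≡∅ x | length-filterᵇ-∨ P Q R P≡Q∨R Q∩R≡∅ xs
... | false | false | false | _  | _      | ih = ih
... | true  | true  | false | _  | _      | ih = cong suc ih
... | true  | false | true  | _  | _      | ih = trans (cong suc ih) (sym (+-suc _ _))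
... | _     | true  | true  | _  | ¬both  | _  = ⊥-elim (¬both (refl , refl))
... | false | true  | false | () | _      | _
... | false | false | true  | () | _      | _
... | true  | false | false | () | _      | _

+-shift : ∀ {c s} r {t} → s ≡ r + t → c + s ≡ r + (c + t)
+-shift {c} {s} r {t} s≡r+t = trans (cong (c +_) s≡r+t) (x∙yz≈y∙xz c r t)

module _ (R : A → B → Bool) where

  sum-length-filterᵇ-∷ : ∀ x xs ys →
    sum (map (λ y → length (filterᵇ (λ x′ → R x′ y) (x ∷ xs))) ys)
      ≡ length (filterᵇ (R x) ys) + sum (map (λ y → length (filterᵇ (λ x′ → R x′ y) xs)) ys)
  sum-length-filterᵇ-∷ x xs [] = refl
  sum-length-filterᵇ-∷ x xs (y ∷ ys) with R x y | sum-length-filterᵇ-∷ x xs ys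
  ... | true  | ih = cong suc (+-shift (length (filterᵇ (R x) ys)) ih)
  ... | false | ih = +-shift (length (filterᵇ (R x) ys)) ih

  sum-length-filterᵇ-swap : ∀ xs ys →
    sum (map (λ x → length (filterᵇ (R x) ys)) xs)
      ≡ sum (map (λ y → length (filterᵇ (λ x → R x y) xs)) ys)
  sum-length-filterᵇ-swap [] ys = sym (sum-zeros ys)
    where
    sum-zeros : ∀ ys → sum (map (λ _ → 0) ys) ≡ 0
    sum-zeros [] = refl
    sum-zeros (_ ∷ ys) = sum-zeros ys
  sum-length-filterᵇ-swap (x ∷ xs) ys =
    trans (cong (length (filterᵇ (R x) ys) +_) (sum-length-filterᵇ-swap xs ys))
          (sym (sum-length-filterᵇ-∷ x xs ys))

sum-map-mono-≤ : {g h : A → ℕ} → (∀ x → g x ≤ h x) → ∀ xs → sum (map g xs) ≤ sum (map h xs)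
sum-map-mono-≤ g≤h []       = z≤n
sum-map-mono-≤ g≤h (x ∷ xs) = +-mono-≤ (g≤h x) (sum-map-mono-≤ g≤h xs)

sum-map-≤∧≡⇒≡ : {g h : A → ℕ} → (∀ x → g x ≤ h x) → ∀ xs →
                sum (map g xs) ≡ sum (map h xs) → ∀ {x} → x ∈ xs → g x ≡ h x
sum-map-≤∧≡⇒≡ {g = g} {h} g≤h (y ∷ xs) Σg≡Σh x∈ with m≤n⇒m<n∨m≡n (g≤h y)
... | inj₁ gy<hy = ⊥-elim (<-irrefl Σg≡Σh (+-mono-<-≤ gy<hy (sum-map-mono-≤ g≤h xs)))
... | inj₂ gy≡hy with x∈
...   | here refl = gy≡hy
...   | there x∈xs = sum-map-≤∧≡⇒≡ g≤h xs Σg≡Σh-tail x∈xs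
  where
  Σg≡Σh-tail : sum (map g xs) ≡ sum (map h xs)
  Σg≡Σh-tail = +-cancelˡ-≡ (g y) _ _ (trans Σg≡Σh (cong (_+ _) (sym gy≡hy)))

pair-≢⇒≡ : {a b x y z : A} → x ≡ a ⊎ x ≡ b → y ≡ a ⊎ y ≡ b → z ≡ a ⊎ z ≡ b →
           x ≢ y → z ≢ x → z ≡ y
pair-≢⇒≡ (inj₁ refl) (inj₁ refl) _           x≢y _   = ⊥-elim (x≢y refl)
pair-≢⇒≡ (inj₂ refl) (inj₂ refl) _           x≢y _   = ⊥-elim (x≢y refl)
pair-≢⇒≡ (inj₁ refl) (inj₂ refl) (inj₁ refl) _   z≢x = ⊥-elim (z≢x refl)
pair-≢⇒≡ (inj₁ refl) (inj₂ refl) (inj₂ refl) _   _   = refl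
pair-≢⇒≡ (inj₂ refl) (inj₁ refl) (inj₁ refl) _   _   = refl
pair-≢⇒≡ (inj₂ refl) (inj₁ refl) (inj₂ refl) _   z≢x = ⊥-elim (z≢x refl)

∉⇒Unique-∷ : {x : A} {xs : List A} → x ∉ xs → Unique xs → Unique (x ∷ xs)
∉⇒Unique-∷ {xs = xs} x∉xs xs! =
  All.tabulate (λ y∈xs x≡y → x∉xs (subst (_∈ xs) (sym x≡y) y∈xs)) ∷ xs!

Unique-map⁺-on : (g : A → B) {xs : List A} →
                 (∀ {x y} → x ∈ xs → y ∈ xs → x ≢ y → g x ≢ g y) → Unique xs → Unique (map g xs)
Unique-map⁺-on g g-inj [] = []
Unique-map⁺-on g g-inj (x≢xs ∷ xs!) =
  All-map⁺ (All.tabulate (λ y∈xs → g-inj (here refl) (there y∈xs) (All.lookup x≢xs y∈xs)))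
  ∷ Unique-map⁺-on g (λ x∈ y∈ → g-inj (there x∈) (there y∈)) xs!

Unique⇒lookup-injective : {xs : List A} → Unique xs → ∀ i j → lookup xs i ≡ lookup xs j → i ≡ j
Unique⇒lookup-injective (x≢xs ∷ xs!) zero    zero    _ = refl
Unique⇒lookup-injective (x≢xs ∷ xs!) zero    (suc j) e = ⊥-elim (All.lookup x≢xs (∈-lookup j) e)
Unique⇒lookup-injective (x≢xs ∷ xs!) (suc i) zero    e = ⊥-elim (All.lookup x≢xs (∈-lookup i) (sym e))
Unique⇒lookup-injective (x≢xs ∷ xs!) (suc i) (suc j) e = cong suc (Unique⇒lookup-injective xs! i j e)

module _ {k : ℕ} where
  open import Data.List.Membership.DecPropositional (_≟_ {k}) using (_∈?_)

  Unique⇒length≤ : {xs : List (Fin k)} → Unique xs → length xs ≤ k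
  Unique⇒length≤ {xs} xs! = ≮⇒≥ λ k<|xs| →
    let (i , j , i<j , xᵢ≡xⱼ) = pigeonhole k<|xs| (lookup xs)
    in  <⇒≢ᶠ i<j (Unique⇒lookup-injective xs! i j xᵢ≡xⱼ)

  Unique∧length≡⇒∈ : {xs : List (Fin k)} → Unique xs → length xs ≡ k → ∀ a → a ∈ xs
  Unique∧length≡⇒∈ {xs} xs! |xs|≡k a with a ∈? xs
  ... | yes a∈xs = a∈xs
  ... | no  a∉xs = ⊥-elim (<-irrefl |xs|≡k (Unique⇒length≤ (∉⇒Unique-∷ a∉xs xs!)))

module _ (G : Graph) where
  open Graph G using (irrefl)

  Adj-sym : ∀ {u v} → Adj G u v → Adj G v u
  Adj-sym {u} {v} uv = trans (Graph.sym G v u) uv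

  Adj⇒≢ : ∀ {u v} → Adj G u v → u ≢ v
  Adj⇒≢ {u} uu refl with () ← trans (sym uu) (irrefl u)

module _ {n k : ℕ} (o : Fin n → Fin n → Bool) (f : Fin n → Fin k) where

  OutColoursAvoidInColours : Set
  OutColoursAvoidInColours = ∀ v x y → o v x ≡ true → o y v ≡ true → f x ≢ f y

  OutColoursDistinct : Set
  OutColoursDistinct = ∀ v x y → o v x ≡ true → o v y ≡ true → x ≢ y → f x ≢ f y

module Orientation (G : Graph) (o : Fin (Graph.n G) → Fin (Graph.n G) → Bool)
                   (ori : IsOrientation G o) where
  open Graph G using (n; adj)

  Arc : Fin n → Fin n → Set
  Arc u v = o u v ≡ true

  Arc⇒Adj : ∀ {u v} → Arc u v → Adj G u v
  Arc⇒Adj {u} {v} uv = trans (sym (proj₁ ori u v)) (cong (_∨ o v u) uv)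

  Arc-asym : ∀ {u v} → Arc u v → Arc v u → ⊥
  Arc-asym uv vu = proj₂ ori _ _ (uv , vu)

  Arc-irrefl : ∀ {v} → ¬ Arc v v
  Arc-irrefl vv = Adj⇒≢ G (Arc⇒Adj vv) refl

  Adj⇒Arc⊎Arc : ∀ {u v} → Adj G u v → Arc u v ⊎ Arc v u
  Adj⇒Arc⊎Arc {u} {v} uv with o u v in ouv
  ... | true  = inj₁ refl
  ... | false = inj₂ (trans (cong (_∨ o v u) (sym ouv)) (trans (proj₁ ori u v) uv))

  outNbrs inNbrs : Fin n → List (Fin n)
  outNbrs v = filterᵇ (o v) (allFin n)
  inNbrs  v = filterᵇ (λ u → o u v) (allFin n)

  outdeg indeg : Fin n → ℕ
  outdeg v = length (outNbrs v)
  indeg  v = length (inNbrs v)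

  ∈-outNbrs⁺ : ∀ {v x} → Arc v x → x ∈ outNbrs v
  ∈-outNbrs⁺ {v} vx = ∈-filter⁺ (T? ∘ o v) (∈-allFin _) (Equivalence.from T-≡ vx)

  ∈-outNbrs⁻ : ∀ {v x} → x ∈ outNbrs v → Arc v x
  ∈-outNbrs⁻ {v} x∈ = Equivalence.to T-≡ (proj₂ (∈-filter⁻ (T? ∘ o v) {xs = allFin n} x∈))

  ∈-inNbrs⁺ : ∀ {v x} → Arc x v → x ∈ inNbrs v
  ∈-inNbrs⁺ {v} xv = ∈-filter⁺ (T? ∘ λ u → o u v) (∈-allFin _) (Equivalence.from T-≡ xv)

  ∈-inNbrs⁻ : ∀ {v x} → x ∈ inNbrs v → Arc x v
  ∈-inNbrs⁻ {v} x∈ = Equivalence.to T-≡ (proj₂ (∈-filter⁻ (T? ∘ λ u → o u v) {xs = allFin n} x∈))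

  outNbrs-Unique : ∀ v → Unique (outNbrs v)
  outNbrs-Unique v = Unique-filter⁺ (T? ∘ o v) (allFin⁺ n)

  inNbrs-Unique : ∀ v → Unique (inNbrs v)
  inNbrs-Unique v = Unique-filter⁺ (T? ∘ λ u → o u v) (allFin⁺ n)

  outdeg+indeg≡degree : ∀ v → outdeg v + indeg v ≡ degree G v
  outdeg+indeg≡degree v =
    sym (length-filterᵇ-∨ (adj v) (o v) (λ u → o u v)
                          (λ u → sym (proj₁ ori v u)) (λ u → proj₂ ori v u) (allFin n))

  sum-outdeg≡sum-indeg : sum (map outdeg (allFin n)) ≡ sum (map indeg (allFin n))
  sum-outdeg≡sum-indeg = sum-length-filterᵇ-swap o (allFin n) (allFin n)

  module _ {k : ℕ} (f : Fin n → Fin k) where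

    inOrientation⇒outColoursAvoidInColours : IsInOrientation G f o → OutColoursAvoidInColours o f
    inOrientation⇒outColoursAvoidInColours (_ , towardsMiddle) v x y vx yv fx≡fy =
      Arc-asym vx (proj₂ (towardsMiddle y v x y≢x (Arc⇒Adj yv) (Arc⇒Adj vx) (sym fx≡fy)))
      where
      y≢x : y ≢ x
      y≢x refl = Arc-asym vx yv

    inOrientation⇒outColoursDistinct : IsInOrientation G f o → OutColoursDistinct o f
    inOrientation⇒outColoursDistinct (_ , towardsMiddle) v x y vx vy x≢y fx≡fy =
      Arc-asym vx (proj₁ (towardsMiddle x v y x≢y (Adj-sym G (Arc⇒Adj vx)) (Arc⇒Adj vy) fx≡fy))

    outColoursAvoidInColours∧Distinct⇒inOrientation :
      OutColoursAvoidInColours o f → OutColoursDistinct o f → IsInOrientation G f o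
    outColoursAvoidInColours∧Distinct⇒inOrientation avoid distinct =
      ori , λ u v w u≢w uv vw fu≡fw →
        towardsMiddle u v w u≢w uv vw fu≡fw ,
        towardsMiddle w v u (u≢w ∘ sym) (Adj-sym G vw) (Adj-sym G uv) (sym fu≡fw)
      where
      towardsMiddle : ∀ u v w → u ≢ w → Adj G u v → Adj G v w → f u ≡ f w → Arc u v
      towardsMiddle u v w u≢w uv vw fu≡fw with Adj⇒Arc⊎Arc uv | Adj⇒Arc⊎Arc vw
      ... | inj₁ u→v | _       = u→v
      ... | inj₂ v→u | inj₁ v→w = ⊥-elim (distinct v u w v→u v→w u≢w fu≡fw)
      ... | inj₂ v→u | inj₂ w→v = ⊥-elim (avoid v u w v→u w→v fu≡fw)

module MINIStructure (p : ℕ) (2≤p : 2 ≤ p) (G : Graph) (reg : Regular G (2 * p))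
  (o : Fin (Graph.n G) → Fin (Graph.n G) → Bool) (ori : IsOrientation G o)
  (f : Fin (Graph.n G) → Fin (p + 2)) (col : IsColouring G (p + 2) f)
  (avoid : OutColoursAvoidInColours o f) (distinct : OutColoursDistinct o f) where
  open Graph G using (n)
  open Orientation G o ori

  outColours : Fin n → List (Fin (p + 2))
  outColours v = map f (outNbrs v)

  outColours-Unique : ∀ v → Unique (outColours v)
  outColours-Unique v =
    Unique-map⁺-on f (λ x∈ y∈ → distinct v _ _ (∈-outNbrs⁻ x∈) (∈-outNbrs⁻ y∈)) (outNbrs-Unique v)

  colour∉outColours : ∀ v → f v ∉ outColours v
  colour∉outColours v fv∈ with ∈-map⁻ f fv∈
  ... | x , x∈ , fv≡fx = col v x (Arc⇒Adj (∈-outNbrs⁻ x∈)) fv≡fx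

  inColour∉outColours : ∀ {v y} → Arc y v → f y ∉ outColours v
  inColour∉outColours {v} {y} yv fy∈ with ∈-map⁻ f fy∈
  ... | x , x∈ , fy≡fx = avoid v x y (∈-outNbrs⁻ x∈) yv (sym fy≡fx)

  Arc⇒colour≢ : ∀ {u v} → Arc u v → f u ≢ f v
  Arc⇒colour≢ uv = col _ _ (Arc⇒Adj uv)

  localColours : Fin n → Fin n → List (Fin (p + 2))
  localColours v y = f v ∷ f y ∷ outColours v

  localColours-Unique : ∀ {v y} → Arc y v → Unique (localColours v y)
  localColours-Unique {v} yv =
    ∉⇒Unique-∷ (λ { (here fv≡fy) → Arc⇒colour≢ yv (sym fv≡fy)
                  ; (there fv∈)  → colour∉outColours v fv∈ })
               (∉⇒Unique-∷ (inColour∉outColours yv) (outColours-Unique v))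

  length-localColours : ∀ v y → length (localColours v y) ≡ outdeg v + 2
  length-localColours v y = trans (cong (2 +_) (length-map f (outNbrs v))) (+-comm 2 (outdeg v))

  outdeg≤p : ∀ v → outdeg v ≤ p
  outdeg≤p v with inNbrs v in inNbrs≡
  ... | y ∷ _ = +-cancelʳ-≤ 2 _ _
                  (subst (_≤ p + 2) (length-localColours v y) (Unique⇒length≤ (localColours-Unique yv)))
    where
    yv : Arc y v
    yv = ∈-inNbrs⁻ (subst (y ∈_) (sym inNbrs≡) (here refl))
  ... | [] = ⊥-elim (<⇒≱ p+2<1+2p
                (subst (_≤ p + 2) (cong suc (length-map f (outNbrs v))) ownAndOutColours≤))
    where
    ownAndOutColours≤ : length (f v ∷ outColours v) ≤ p + 2
    ownAndOutColours≤ = Unique⇒length≤ (∉⇒Unique-∷ (colour∉outColours v) (outColours-Unique v))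
    outdeg≡2p : outdeg v ≡ 2 * p
    outdeg≡2p = trans (sym (+-identityʳ _)) (trans (cong (λ ys → outdeg v + length ys) (sym inNbrs≡))
                                                   (trans (outdeg+indeg≡degree v) (reg v)))
    p+2<1+2p : p + 2 < suc (outdeg v)
    p+2<1+2p = s≤s (subst (p + 2 ≤_) (sym outdeg≡2p) (+-monoʳ-≤ p (≤-trans 2≤p (m≤m+n p 0))))

  outdeg≤indeg : ∀ v → outdeg v ≤ indeg v
  outdeg≤indeg v = +-cancelˡ-≤ (outdeg v) _ _
    (subst (outdeg v + outdeg v ≤_) (trans (sym (reg v)) (sym (outdeg+indeg≡degree v)))
           (+-mono-≤ (outdeg≤p v) (≤-trans (outdeg≤p v) (m≤m+n p 0))))

  outdeg≡indeg : ∀ v → outdeg v ≡ indeg v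
  outdeg≡indeg v = sum-map-≤∧≡⇒≡ outdeg≤indeg (allFin n) sum-outdeg≡sum-indeg (∈-allFin v)

  outdeg≡p : ∀ v → outdeg v ≡ p
  outdeg≡p v = *-cancelˡ-≡ (outdeg v) p 2 (begin
    outdeg v + (outdeg v + 0) ≡⟨ cong (outdeg v +_) (trans (+-identityʳ _) (outdeg≡indeg v)) ⟩
    outdeg v + indeg v        ≡⟨ outdeg+indeg≡degree v ⟩
    degree G v                ≡⟨ reg v ⟩
    2 * p                     ∎)
    where open ≡-Reasoning

  indeg≡p : ∀ v → indeg v ≡ p
  indeg≡p v = trans (sym (outdeg≡indeg v)) (outdeg≡p v)

  length-localColours≡p+2 : ∀ v y → length (localColours v y) ≡ p + 2
  length-localColours≡p+2 v y = trans (length-localColours v y) (cong (_+ 2) (outdeg≡p v))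

  inColoursEqual : ∀ v x y → Arc x v → Arc y v → f x ≡ f y
  inColoursEqual v x y xv yv with f x ≟ f y
  ... | yes fx≡fy = fx≡fy
  ... | no  fx≢fy = ⊥-elim (<-irrefl (length-localColours≡p+2 v y)
                                     (Unique⇒length≤ (∉⇒Unique-∷ fx∉ (localColours-Unique yv))))
    where
    fx∉ : f x ∉ localColours v y
    fx∉ (here fx≡fv)          = Arc⇒colour≢ xv fx≡fv
    fx∉ (there (here fx≡fy))  = fx≢fy fx≡fy
    fx∉ (there (there fx∈))   = inColour∉outColours xv fx∈

  inNbr : ∀ v → ∃[ y ] Arc y v
  inNbr v with inNbrs v in inNbrs≡
  ... | y ∷ _ = y , ∈-inNbrs⁻ (subst (y ∈_) (sym inNbrs≡) (here refl))
  ... | []    with () ← ≤-trans 2≤p (≤-reflexive (trans (sym (indeg≡p v)) (cong length inNbrs≡)))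

  inColour : Fin n → Fin (p + 2)
  inColour v = f (proj₁ (inNbr v))

  inColour-spec : ∀ {y v} → Arc y v → f y ≡ inColour v
  inColour-spec {y} {v} yv = inColoursEqual v y _ yv (proj₂ (inNbr v))

  inColour≢colour : ∀ v → inColour v ≢ f v
  inColour≢colour v = Arc⇒colour≢ (proj₂ (inNbr v))

  outColour≢inColour : ∀ {v x} → Arc v x → f x ≢ inColour v
  outColour≢inColour {v} {x} vx fx≡in =
    avoid v x _ vx (proj₂ (inNbr v)) (trans fx≡in (sym (inColour-spec (proj₂ (inNbr v)))))

  outColour-exists : ∀ v c → c ≢ f v → c ≢ inColour v → ∃[ x ] Arc v x × f x ≡ c
  outColour-exists v c c≢fv c≢in with inNbr v
  ... | y , yv with Unique∧length≡⇒∈ (localColours-Unique yv) (length-localColours≡p+2 v y) c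
  ...   | here c≡fv         = ⊥-elim (c≢fv c≡fv)
  ...   | there (here c≡fy) = ⊥-elim (c≢in c≡fy)
  ...   | there (there c∈)  with ∈-map⁻ f c∈
  ...     | x , x∈ , c≡fx   = x , ∈-outNbrs⁻ x∈ , sym c≡fx

  ClosedInNbhd : Fin n → Fin n → Set
  ClosedInNbhd c w = w ≡ c ⊎ Arc w c

  module BicolouredComponent (a b : Fin (p + 2)) where
    InPair : Fin (p + 2) → Set
    InPair c = c ≡ a ⊎ c ≡ b

    Component : Fin n → Fin n → Set
    Component = Reach G (TwoColoured G f a b)

    -- A centre c, whose colour and in-colour form the pair, has c together with its
    -- in-neighbours as bicoloured component: a copy of K_{1,p}.
    module Centred (c : Fin n) (c-ab : InPair (f c)) (in-ab : InPair (inColour c)) where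

      ClosedInNbhd⇒InPair : ∀ {w} → ClosedInNbhd c w → InPair (f w)
      ClosedInNbhd⇒InPair (inj₁ refl) = c-ab
      ClosedInNbhd⇒InPair (inj₂ wc)   = subst InPair (sym (inColour-spec wc)) in-ab

      ClosedInNbhd-closed : ∀ {w w′} → ClosedInNbhd c w → Adj G w w′ → InPair (f w′) →
                            ClosedInNbhd c w′
      ClosedInNbhd-closed (inj₁ refl) cw′ w′-ab with Adj⇒Arc⊎Arc cw′
      ... | inj₂ w′c = inj₂ w′c
      ... | inj₁ cw′ = ⊥-elim (outColour≢inColour cw′ (pair-≢⇒≡ c-ab in-ab w′-ab
                                  (inColour≢colour c ∘ sym) (Arc⇒colour≢ cw′ ∘ sym)))
      ClosedInNbhd-closed {w} {w′} (inj₂ wc) ww′ w′-ab = go (Adj⇒Arc⊎Arc ww′)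
        where
        fw′≡fc : f w′ ≡ f c
        fw′≡fc = pair-≢⇒≡ in-ab c-ab w′-ab (inColour≢colour c)
                   (λ fw′≡in → col w w′ ww′ (trans (inColour-spec wc) (sym fw′≡in)))
        go : Arc w w′ ⊎ Arc w′ w → ClosedInNbhd c w′
        go (inj₁ w→w′) with w′ ≟ c
        ... | yes w′≡c = inj₁ w′≡c
        ... | no  w′≢c = ⊥-elim (distinct w w′ c w→w′ wc w′≢c fw′≡fc)
        go (inj₂ w′→w) = ⊥-elim (avoid w c w′ wc w′→w (sym fw′≡fc))

      Component⇒ClosedInNbhd : ∀ {v w} → ClosedInNbhd c v → Component v w → ClosedInNbhd c w
      Component⇒ClosedInNbhd cv (here _)            = cv
      Component⇒ClosedInNbhd cv (step vw ww′ w′-ab) =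
        ClosedInNbhd-closed (Component⇒ClosedInNbhd cv vw) ww′ w′-ab

      ClosedInNbhd⇒Component-centre : ∀ {v} → ClosedInNbhd c v → Component v c
      ClosedInNbhd⇒Component-centre (inj₁ refl) = here c-ab
      ClosedInNbhd⇒Component-centre (inj₂ vc)   =
        step (here (ClosedInNbhd⇒InPair (inj₂ vc))) (Arc⇒Adj vc) c-ab

      ClosedInNbhd⇒Component : ∀ {v w} → ClosedInNbhd c v → ClosedInNbhd c w → Component v w
      ClosedInNbhd⇒Component cv (inj₁ refl) = ClosedInNbhd⇒Component-centre cv
      ClosedInNbhd⇒Component cv (inj₂ wc)   =
        step (ClosedInNbhd⇒Component-centre cv) (Adj-sym G (Arc⇒Adj wc)) (ClosedInNbhd⇒InPair (inj₂ wc))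

      leaf : Fin (indeg c) → Fin n
      leaf = lookup (inNbrs c)

      leaf→c : ∀ i → Arc (leaf i) c
      leaf→c i = ∈-inNbrs⁻ (∈-lookup i)

      φ : Fin (suc (indeg c)) → Fin n
      φ zero    = c
      φ (suc i) = leaf i

      φ-injective : ∀ i j → φ i ≡ φ j → i ≡ j
      φ-injective zero    zero    _ = refl
      φ-injective zero    (suc j) c≡ = ⊥-elim (Arc-irrefl (subst (λ x → Arc x c) (sym c≡) (leaf→c j)))
      φ-injective (suc i) zero    ≡c = ⊥-elim (Arc-irrefl (subst (λ x → Arc x c) ≡c (leaf→c i)))
      φ-injective (suc i) (suc j) e  = cong suc (Unique⇒lookup-injective (inNbrs-Unique c) i j e)

      φ-onto : ∀ w → ClosedInNbhd c w → ∃[ i ] φ i ≡ w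
      φ-onto w (inj₁ refl) = zero , refl
      φ-onto w (inj₂ wc)   = suc (Any.index w∈) , sym (lookup-index w∈)
        where
        w∈ : w ∈ inNbrs c
        w∈ = ∈-inNbrs⁺ wc

      φ-ClosedInNbhd : ∀ i → ClosedInNbhd c (φ i)
      φ-ClosedInNbhd zero    = inj₁ refl
      φ-ClosedInNbhd (suc i) = inj₂ (leaf→c i)

      φ-Adj : ∀ i j → (Adj G (φ i) (φ j) → StarAdj G i j) × (StarAdj G i j → Adj G (φ i) (φ j))
      φ-Adj zero zero       = (λ cc → ⊥-elim (Adj⇒≢ G cc refl)) ,
                              λ { (inj₁ (_ , 0≢0)) → ⊥-elim (0≢0 refl) ; (inj₂ (0≢0 , _)) → ⊥-elim (0≢0 refl) }
      φ-Adj zero (suc j)    = (λ _ → inj₁ (refl , λ ())) , (λ _ → Adj-sym G (Arc⇒Adj (leaf→c j)))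
      φ-Adj (suc i) zero    = (λ _ → inj₂ ((λ ()) , refl)) , (λ _ → Arc⇒Adj (leaf→c i))
      φ-Adj (suc i) (suc j) = (λ ij → ⊥-elim (col _ _ ij (inColoursEqual c _ _ (leaf→c i) (leaf→c j)))) ,
                              λ { (inj₁ (() , _)) ; (inj₂ (_ , ())) }

      Component≅K1p : ∀ {v} → ClosedInNbhd c v → InducedIsoStar G (Component v) p
      Component≅K1p {v} cv = subst (InducedIsoStar G (Component v)) (indeg≡p c)
        (φ , φ-injective , (λ w → φ-onto w ∘ Component⇒ClosedInNbhd cv) ,
         ClosedInNbhd⇒Component cv ∘ φ-ClosedInNbhd , φ-Adj)

    otherColour : a ≢ b → ∀ {c} → InPair c → ∃[ d ] InPair d × d ≢ c
    otherColour a≢b (inj₁ c≡a) = b , inj₂ refl , λ b≡c → a≢b (trans (sym c≡a) (sym b≡c))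
    otherColour a≢b (inj₂ c≡b) = a , inj₁ refl , λ a≡c → a≢b (trans a≡c c≡b)

    -- The centre is v itself if its in-colour is the other colour of the pair,
    -- and otherwise the out-neighbour of v having that colour.
    centre : ∀ {v} → a ≢ b → InPair (f v) →
             ∃[ c ] InPair (f c) × InPair (inColour c) × ClosedInNbhd c v
    centre {v} a≢b v-ab with otherColour a≢b v-ab
    ... | d , d-ab , d≢fv with inColour v ≟ d
    ...   | yes in≡d = v , v-ab , subst InPair (sym in≡d) d-ab , inj₁ refl
    ...   | no  in≢d with outColour-exists v d d≢fv (in≢d ∘ sym)
    ...     | x , vx , fx≡d =
      x , subst InPair (sym fx≡d) d-ab , subst InPair (inColour-spec vx) v-ab , inj₂ vx

  allBicolouredComponentsK1p : AllBicolouredComponentsK1 G f p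
  allBicolouredComponentsK1p a b a≢b v v-ab =
    let (c , c-ab , in-ab , cv) = BicolouredComponent.centre a b a≢b v-ab
    in  BicolouredComponent.Centred.Component≅K1p a b c c-ab in-ab cv

  ψ : Fin n → Fin (p + 2) × Fin (p + 2)
  ψ v = inColour v , f v

  ψ-isOutNbhdBijHom : IsOutNbhdBijHom G (p + 2) o ψ
  ψ-isOutNbhdBijHom = inColour≢colour , ψ-LArc , ψ-injective , ψ-onto
    where
    ψ-LArc : ∀ v x → Arc v x → LArc (ψ v) (ψ x)
    ψ-LArc v x vx = sym (inColour-spec vx) , outColour≢inColour vx
    ψ-injective : ∀ v x y → Arc v x → Arc v y → ψ x ≡ ψ y → x ≡ y
    ψ-injective v x y vx vy ψx≡ψy with x ≟ y
    ... | yes x≡y = x≡y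
    ... | no  x≢y = ⊥-elim (distinct v x y vx vy x≢y (cong proj₂ ψx≡ψy))
    ψ-onto : ∀ v t → proj₁ t ≢ proj₂ t → LArc (ψ v) t → ∃[ x ] (Arc v x × ψ x ≡ t)
    ψ-onto v (i , j) i≢j (i≡fv , j≢in)
      with outColour-exists v j (λ j≡fv → i≢j (trans i≡fv (sym j≡fv))) j≢in
    ... | x , vx , fx≡j = x , vx , cong₂ _,_ (trans (sym (inColour-spec vx)) (sym i≡fv)) fx≡j

outNbhdBijHom⇒MINI : ∀ {k} (G : Graph) (o : Fin (Graph.n G) → Fin (Graph.n G) → Bool) →
  IsOrientation G o → (f : Fin (Graph.n G) → Fin k) → IsColouring G k f →
  ∀ ψ → IsOutNbhdBijHom G k o ψ → (∀ v → proj2 (ψ v) ≡ f v) → IsMINI G f o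
outNbhdBijHom⇒MINI G o ori f col ψ (_ , ψ-LArc , ψ-injective , _) proj2∘ψ≡f =
  ori , col , avoid , distinct , inEqual
  where
  open ≡-Reasoning
  avoid : OutColoursAvoidInColours o f
  avoid v x y vx yv fx≡fy = proj₂ (ψ-LArc v x vx) (begin
    proj₂ (ψ x)  ≡⟨ proj2∘ψ≡f x ⟩
    f x          ≡⟨ fx≡fy ⟩
    f y          ≡⟨ proj2∘ψ≡f y ⟨
    proj₂ (ψ y)  ≡⟨ proj₁ (ψ-LArc y v yv) ⟨
    proj₁ (ψ v)  ∎)
  distinct : OutColoursDistinct o f
  distinct v x y vx vy x≢y fx≡fy = x≢y (ψ-injective v x y vx vy (cong₂ _,_
    (trans (proj₁ (ψ-LArc v x vx)) (sym (proj₁ (ψ-LArc v y vy))))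
    (trans (proj2∘ψ≡f x) (trans fx≡fy (sym (proj2∘ψ≡f y))))))
  inEqual : ∀ v x y → o x v ≡ true → o y v ≡ true → f x ≡ f y
  inEqual v x y xv yv = begin
    f x          ≡⟨ sym (proj2∘ψ≡f x) ⟩
    proj₂ (ψ x)  ≡⟨ proj₁ (ψ-LArc x v xv) ⟨
    proj₁ (ψ v)  ≡⟨ proj₁ (ψ-LArc y v yv) ⟩
    proj₂ (ψ y)  ≡⟨ proj2∘ψ≡f y ⟩
    f y          ∎

module _ (G : Graph) where
  open Graph G using (n; adj)

  InducedIsoStar⇒noP₄ : ∀ {C q} → InducedIsoStar G C q →
                        ∀ {x y z t} → C x → C y → C z → C t →
                        Adj G x y → Adj G y z → Adj G z t → x ≢ z → y ≢ t → ⊥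
  InducedIsoStar⇒noP₄ (φ , _ , onto , _ , φ-Adj) cx cy cz ct xy yz zt x≢z y≢t
    with onto _ cx | onto _ cy | onto _ cz | onto _ ct
  ... | i , refl | j , refl | l , refl | m , refl =
    noP₄ (proj₁ (φ-Adj i j) xy) (proj₁ (φ-Adj j l) yz) (proj₁ (φ-Adj l m) zt)
    where
    noP₄ : StarAdj G i j → StarAdj G j l → StarAdj G l m → ⊥
    noP₄ (inj₁ (_   , j≢0)) (inj₁ (j≡0 , _))   _                 = j≢0 j≡0
    noP₄ (inj₁ (i≡0 , _))   (inj₂ (_   , l≡0)) _                 = x≢z (cong φ (trans i≡0 (sym l≡0)))
    noP₄ (inj₂ (_   , j≡0)) (inj₂ (j≢0 , _))   _                 = j≢0 j≡0
    noP₄ (inj₂ (_   , _))   (inj₁ (_   , l≢0)) (inj₁ (l≡0 , _))  = l≢0 l≡0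
    noP₄ (inj₂ (_   , j≡0)) (inj₁ (_   , _))   (inj₂ (_ , m≡0))  = y≢t (cong φ (trans j≡0 (sym m≡0)))

  module _ {k : ℕ} (f : Fin n → Fin k) where

    -- u, v, w is a bicoloured path, so an in-orientation must orient uv towards v.
    Forced : Fin n → Fin n → Set
    Forced u v = ∃[ w ] Adj G v w × f w ≡ f u × w ≢ u

    forced? : ∀ u v → Dec (Forced u v)
    forced? u v = any? λ w → (adj v w Bool.≟ true) ×-dec (f w ≟ f u) ×-dec ¬? (w ≟ u)

    starColouring⇒¬Forced-both : IsStarColouring G f →
                                 ∀ {u v} → Adj G u v → Forced u v → Forced v u → ⊥
    starColouring⇒¬Forced-both (col , stars) {u} {v} uv
                               (w , vw , fw≡fu , w≢u) (w′ , uw′ , fw′≡fv , w′≢v)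
      with stars (f u) (f v) (col u v uv) u (inj₁ refl)
    ... | _ , iso =
      InducedIsoStar⇒noP₄ iso cw cv cu cw′ (Adj-sym G vw) (Adj-sym G uv) uw′ w≢u (w′≢v ∘ sym)
      where
      C : Fin n → Set
      C = Reach G (TwoColoured G f (f u) (f v)) u
      cu : C u
      cu = here (inj₁ refl)
      cv : C v
      cv = step cu uv (inj₂ refl)
      cw : C w
      cw = step cv vw (inj₁ fw≡fu)
      cw′ : C w′
      cw′ = step cu uw′ (inj₂ fw′≡fv)

    reorient : (Fin n → Fin n → Bool) → Fin n → Fin n → Bool
    reorient o u v = adj u v ∧ (⌊ forced? u v ⌋ ∨ (not ⌊ forced? v u ⌋ ∧ o u v))

    module _ (st : IsStarColouring G f) (o : Fin n → Fin n → Bool) (ori : IsOrientation G o) where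

      reorient-isOrientation : IsOrientation G (reorient o)
      reorient-isOrientation = covers , asym
        where
        covers : ∀ u v → (reorient o u v ∨ reorient o v u) ≡ adj u v
        covers u v with adj u v in uv | adj v u in vu
        ... | false | false = refl
        ... | true  | false with () ← trans (sym vu) (Adj-sym G uv)
        ... | false | true  with () ← trans (sym uv) (Adj-sym G vu)
        ... | true  | true  with forced? u v | forced? v u
        ...   | yes _ | _     = refl
        ...   | no  _ | yes _ = refl
        ...   | no  _ | no  _ = trans (proj₁ ori u v) uv
        asym : ∀ u v → ¬ (reorient o u v ≡ true × reorient o v u ≡ true)
        asym u v with adj u v in uv | adj v u
        ... | false | _    = λ { (() , _) }
        ... | true  | false = λ { (_ , ()) }
        ... | true  | true with forced? u v | forced? v u
        ...   | yes Fuv | yes Fvu = λ _ → starColouring⇒¬Forced-both st uv Fuv Fvu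
        ...   | yes _   | no  _   = λ { (_ , ()) }
        ...   | no  _   | yes _   = λ { (() , _) }
        ...   | no  _   | no  _   = proj₂ ori u v

      reorient-isInOrientation : IsInOrientation G f (reorient o)
      reorient-isInOrientation = reorient-isOrientation , λ u v w u≢w uv vw fu≡fw →
        Forced⇒arc uv (w , vw , sym fu≡fw , u≢w ∘ sym) ,
        Forced⇒arc (Adj-sym G vw) (u , Adj-sym G uv , fu≡fw , u≢w)
        where
        Forced⇒arc : ∀ {u v} → Adj G u v → Forced u v → reorient o u v ≡ true
        Forced⇒arc {u} {v} uv Fuv rewrite uv with forced? u v
        ... | yes _   = refl
        ... | no  ¬F = ⊥-elim (¬F Fuv)

MINI⇒inOrientation : ∀ (G : Graph) {k} (f : Fin (Graph.n G) → Fin k) {o} →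
                     IsMINI G f o → IsInOrientation G f o
MINI⇒inOrientation G f {o} (ori , _ , avoid , distinct , _) =
  Orientation.outColoursAvoidInColours∧Distinct⇒inOrientation G o ori f avoid distinct

K1p⇒starColouring : ∀ (G : Graph) {k} (f : Fin (Graph.n G) → Fin k) → IsColouring G k f →
                    ∀ {p} → AllBicolouredComponentsK1 G f p → IsStarColouring G f
K1p⇒starColouring G f col {p} K1p = col , λ a b a≢b v v-ab → p , K1p a b a≢b v v-ab

module MINIOrientations (p : ℕ) (2≤p : 2 ≤ p) (G : Graph) (reg : Regular G (2 * p))
  (f : Fin (Graph.n G) → Fin (p + 2)) (col : IsColouring G (p + 2) f) where

  MINI⇒K1p : ∀ {o} → IsMINI G f o → AllBicolouredComponentsK1 G f p
  MINI⇒K1p {o} (ori , _ , avoid , distinct , _) =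
    MINIStructure.allBicolouredComponentsK1p p 2≤p G reg o ori f col avoid distinct

  MINI⇒outNbhdBijHom : ∀ {o} → IsMINI G f o →
                       ∃[ ψ ] (IsOutNbhdBijHom G (p + 2) o ψ × (∀ v → proj2 (ψ v) ≡ f v))
  MINI⇒outNbhdBijHom {o} (ori , _ , avoid , distinct , _) = ψ , ψ-isOutNbhdBijHom , λ _ → refl
    where open MINIStructure p 2≤p G reg o ori f col avoid distinct

  inOrientation⇒MINI : ∀ {o} → IsInOrientation G f o → IsMINI G f o
  inOrientation⇒MINI {o} inOri@(ori , _) = ori , col , avoid , distinct , inColoursEqual
    where
    open Orientation G o ori
    avoid : OutColoursAvoidInColours o f
    avoid = inOrientation⇒outColoursAvoidInColours f inOri
    distinct : OutColoursDistinct o f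
    distinct = inOrientation⇒outColoursDistinct f inOri
    open MINIStructure p 2≤p G reg o ori f col avoid distinct using (inColoursEqual)

lemma5 : (p : ℕ) → 2 ≤ p → (G : Graph) → Regular G (2 * p)
       → (o : Fin (Graph.n G) → Fin (Graph.n G) → Bool) → IsOrientation G o
       → (f : Fin (Graph.n G) → Fin (p + 2)) → IsColouring G (p + 2) f
       → (IsStarColouring G f ⇔ AllBicolouredComponentsK1 G f p)
       × ((IsStarColouring G f × IsInOrientation G f o) ⇔ IsMINI G f o)
       × (IsMINI G f o
           ⇔ (∃[ ψ ] (IsOutNbhdBijHom G (p + 2) o ψ × (∀ v → proj2 (ψ v) ≡ f v))))
lemma5 p 2≤p G reg o ori f col =
  mk⇔ (λ st → MINI⇒K1p (inOrientation⇒MINI (reorient-isInOrientation G f st o ori)))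
      (K1p⇒starColouring G f col) ,
  mk⇔ (λ (_ , inOri) → inOrientation⇒MINI inOri)
      (λ mini → K1p⇒starColouring G f col (MINI⇒K1p mini) , MINI⇒inOrientation G f mini) ,
  mk⇔ MINI⇒outNbhdBijHom
      (λ (ψ , hom , proj2∘ψ≡f) → outNbhdBijHom⇒MINI G o ori f col ψ hom proj2∘ψ≡f)
  where open MINIOrientations p 2≤p G reg f col
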